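{- Let $G=(V,E)$ be a graph whose minimum non-empty cut has size $\ell$, and let $C\subseteq E$ be the edge set of a cut of size in $[\ell,1.01\ell]$. Let $G-C$ be obtained by deleting all edges of $C$. Then (1) $G-C$ has exactly one more connected component than $G$, and (2) the minimum non-empty cut of $G-C$ has size at least $0.2\ell$.
   Context: A cut is the set of edges between some $S\subseteq V$ and $V\setminus S$; a non-empty cut is one whose edge set is non-empty. -}

module Defs where

open import Data.Nat using (ℕ; zero; suc; _+_)
import Data.Nat
open import Data.Bool using (Bool; true; false; not; _∧_; T)
open import Data.Fin using (Fin; zero; suc)
open import Data.Product using (Σ; ∃; _×_; _,_)
open import Relation.Binary.PropositionalEquality using (_≡_; refl; cong₂)
open import Relation.Binary.Construct.Closure.ReflexiveTransitive using (Star)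

record Graph (n : ℕ) : Set where
  field
    adj    : Fin n → Fin n → Bool
    adj-sym : ∀ u v → adj u v ≡ adj v u
    adj-irrefl : ∀ u → adj u u ≡ false
open Graph public

VSubset : ℕ → Set
VSubset n = Fin n → Bool

bool→ℕ : Bool → ℕ
bool→ℕ true  = 1
bool→ℕ false = 0

count : ∀ {n} → (Fin n → Bool) → ℕ
count {zero}  f = 0
count {suc n} f = bool→ℕ (f zero) + count (λ i → f (suc i))

sumFin : ∀ {n} → (Fin n → ℕ) → ℕ
sumFin {zero}  f = 0
sumFin {suc n} f = f zero + sumFin (λ i → f (suc i))

crosses : ∀ {n} → VSubset n → Fin n → Fin n → Bool
crosses S u v with S u | S v
... | true  | false = true
... | false | true  = true
... | _     | _     = false

-- the edges of the cut (S, V∖S): edges uv with u ∈ S and v ∉ S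
-- (each edge of the cut is counted exactly once)
inCut : ∀ {n} → Graph n → VSubset n → Fin n → Fin n → Bool
inCut G S u v = adj G u v ∧ (S u ∧ not (S v))

cutSize : ∀ {n} → Graph n → VSubset n → ℕ
cutSize G S = sumFin (λ u → count (λ v → inCut G S u v))

IsMinNonEmptyCut : ∀ {n} → Graph n → ℕ → Set
IsMinNonEmptyCut G ℓ =
  (Σ (VSubset _) λ S → 0 Data.Nat.< cutSize G S × cutSize G S ≡ ℓ)
  × (∀ S → 0 Data.Nat.< cutSize G S → ℓ Data.Nat.≤ cutSize G S)

private
  crosses-sym : ∀ {n} (S : VSubset n) u v → crosses S u v ≡ crosses S v u
  crosses-sym S u v with S u | S v
  ... | true  | true  = refl
  ... | true  | false = refl
  ... | false | true  = refl
  ... | false | false = refl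

deleteCut : ∀ {n} → Graph n → VSubset n → Graph n
deleteCut G T = record
  { adj = λ u v → adj G u v ∧ not (crosses T u v)
  ; adj-sym = λ u v → cong₂ (λ a b → a ∧ not b) (adj-sym G u v) (crosses-sym T u v)
  ; adj-irrefl = λ u → cong₂ (λ a b → a ∧ b) (adj-irrefl G u) refl
  }

Connected : ∀ {n} → Graph n → Fin n → Fin n → Set
Connected G = Star (λ u v → T (adj G u v))

-- G has exactly k connected components: there is a surjective labelling
-- of the vertices by Fin k whose fibres are exactly the components.
HasComponents : ∀ {n} → Graph n → ℕ → Set
HasComponents {n} G k =
  Σ (Fin n → Fin k) λ f →
    (∀ i → ∃ λ u → f u ≡ i)
    × (∀ u v → f u ≡ f v → Connected G u v)
    × (∀ u v → Connected G u v → f u ≡ f v)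

module Submission where

-- Let C be the cut of S, of size at most 1.01ℓ, and let p be either side of it; both sides have
-- cut C. For any vertex set q, the cuts of p ∩ q and p ∖ q together have at most |C| + 2e edges,
-- where e counts the edges between p ∩ q and p ∖ q. If both cuts are non-empty, each has at
-- least ℓ edges, so 2ℓ ≤ 2e + 1.01ℓ and hence ℓ ≤ 5e.
--
-- For a cut S′ of G − C, an edge of G − C crossing S′ lies inside one side p; taking q = S′, the
-- e edges are edges of G − C crossing S′, which gives (2). If q is closed under the edges of G
-- inside p then e = 0, so p ∩ q and p ∖ q cannot both have non-empty cuts. With q the vertices
-- reachable from u ∈ p in G − C, this shows that every vertex of p in the component of u is
-- still connected to u in G − C; with q the component of an edge of C, it shows that all edges
-- of C lie in a single component. Hence deleting C splits exactly that component, into its two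
-- sides.

open import Defs
import Algebra.Properties.CommutativeMonoid.Sum as MonoidSum
open import Data.Bool using (Bool; true; false; not; _∧_; _∨_; T)
import Data.Bool as Bool
open import Data.Bool.Properties using (T?; T-≡; T-not-≡; T-∧; T-∨; ∧-comm; not-involutive)
open import Data.Empty using (⊥; ⊥-elim)
open import Data.Fin using (Fin; zero; suc; _≟_)
open import Data.Fin.Properties using (any?; 0≢1+n; suc-injective)
open import Data.List using (_∷_; [])
open import Data.Nat using (ℕ; zero; suc; _+_; _*_; _≤_; _<_; z≤n; s≤s)
open import Data.Nat.GeneralisedArithmetic using (fold)
open import Data.Nat.Properties
  using ( ≤-refl; ≤-trans; <-≤-trans; ≤-<-trans; <⇒≱; ≮⇒≥; 1+n≰n; m≤m+n; m<m+n
        ; +-mono-≤; +-monoʳ-≤; +-cancelʳ-≤; *-monoˡ-≤; *-monoʳ-≤; *-cancelˡ-≤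
        ; +-0-commutativeMonoid; +-commutativeSemigroup; module ≤-Reasoning )
open import Data.Nat.Tactic.RingSolver using (solve)
open import Data.Product using (∃; ∃₂; _×_; _,_; proj₁; proj₂; uncurry)
open import Data.Sum using (_⊎_; inj₁; inj₂; [_,_]′)
open import Function using (_∘_; _⇔_; Equivalence)
open import Relation.Binary.Construct.Closure.ReflexiveTransitive as Star
  using (Star; ε; _◅_; _◅◅_; reverse)
open import Relation.Binary.PropositionalEquality
open import Relation.Nullary using (¬_; yes; no; ¬?; _×-dec_)
open import Relation.Nullary.Decidable using (⌊_⌋; toWitness; fromWitness; decidable-stable)

open import Algebra.Properties.CommutativeSemigroup +-commutativeSemigroup using (interchange)
open MonoidSum +-0-commutativeMonoid using (sum; ∑-distrib-+; ∑-comm; sum-remove; sum-cong-≗)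
open Equivalence using (to; from)

private
  variable
    n : ℕ

∧-intro : ∀ {a b} → T a → T b → T (a ∧ b)
∧-intro {true} _ tb = tb

∧-elim : ∀ {a b} → T (a ∧ b) → T a × T b
∧-elim = to T-∧

not-intro : ∀ {a} → ¬ T a → T (not a)
not-intro {false} _   = _
not-intro {true}  ¬ta = ¬ta _

not-elim : ∀ {a} → T (not a) → ¬ T a
not-elim {false} _ ()

∁ : VSubset n → VSubset n
∁ X v = not (X v)

_∩_ _∖_ : VSubset n → VSubset n → VSubset n
(X ∩ Y) v = X v ∧ Y v
(X ∖ Y) v = X v ∧ not (Y v)

_⊆_ : VSubset n → VSubset n → Set
X ⊆ Y = ∀ v → T (X v) → T (Y v)

bool→ℕ-mono : ∀ {a b} → (T a → T b) → bool→ℕ a ≤ bool→ℕ b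
bool→ℕ-mono {false}         _ = z≤n
bool→ℕ-mono {true}  {true}  _ = ≤-refl
bool→ℕ-mono {true}  {false} h = ⊥-elim (h _)

bool→ℕ-+-≤ : ∀ {a b c} → (T a → T c) → (T b → T c) → (T a → T b → ⊥) →
             bool→ℕ a + bool→ℕ b ≤ bool→ℕ c
bool→ℕ-+-≤ {false}         _   b⇒c _    = bool→ℕ-mono b⇒c
bool→ℕ-+-≤ {true}  {false} a⇒c _   _    = bool→ℕ-mono a⇒c
bool→ℕ-+-≤ {true}  {true}  _   _   disj = ⊥-elim (disj _ _)

bool→ℕ-≤-+ : ∀ {a b c} → (T c → T a ⊎ T b) → bool→ℕ c ≤ bool→ℕ a + bool→ℕ b
bool→ℕ-≤-+ {c = false}                _     = z≤n
bool→ℕ-≤-+ {true}  {c = true}         _     = s≤s z≤n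
bool→ℕ-≤-+ {false} {true}  {true}     _     = ≤-refl
bool→ℕ-≤-+ {false} {false} {true}     cover = [ ⊥-elim , ⊥-elim ]′ (cover _)

bool→ℕ-pos : ∀ {a} → T a → 0 < bool→ℕ a
bool→ℕ-pos {true} _ = s≤s z≤n

bool→ℕ-pos⁻¹ : ∀ {a} → 0 < bool→ℕ a → T a
bool→ℕ-pos⁻¹ {true} _ = _

sumFin≡sum : (f : Fin n → ℕ) → sumFin f ≡ sum f
sumFin≡sum {zero}  f = refl
sumFin≡sum {suc n} f = cong (f zero +_) (sumFin≡sum (f ∘ suc))

count≡sum : (X : VSubset n) → count X ≡ sum (bool→ℕ ∘ X)
count≡sum {zero}  X = refl
count≡sum {suc n} X = cong (bool→ℕ (X zero) +_) (count≡sum (X ∘ suc))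

sum-mono : {f g : Fin n → ℕ} → (∀ i → f i ≤ g i) → sum f ≤ sum g
sum-mono {zero}  _ = z≤n
sum-mono {suc n} h = +-mono-≤ (h zero) (sum-mono (h ∘ suc))

sum-+-≤ : {f g h : Fin n → ℕ} → (∀ i → f i + g i ≤ h i) → sum f + sum g ≤ sum h
sum-+-≤ {f = f} {g} le = subst (_≤ _) (∑-distrib-+ f g) (sum-mono le)

sum-≤-+ : {f g h : Fin n → ℕ} → (∀ i → h i ≤ f i + g i) → sum h ≤ sum f + sum g
sum-≤-+ {f = f} {g} le = subst (_ ≤_) (∑-distrib-+ f g) (sum-mono le)

≤-sum : (f : Fin n → ℕ) (i : Fin n) → f i ≤ sum f
≤-sum {suc n} f i = subst (f i ≤_) (sym (sum-remove f)) (m≤m+n _ _)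

sum-witness : (f : Fin n → ℕ) → 0 < sum f → ∃ λ i → 0 < f i
sum-witness {suc n} f pos with f zero in eq
... | suc _ = zero , subst (0 <_) (sym eq) (s≤s z≤n)
... | zero  with i , pos′ ← sum-witness (f ∘ suc) pos = suc i , pos′

count-≤ : (X : VSubset n) → count X ≤ n
count-≤ {zero}  X = z≤n
count-≤ {suc n} X = +-mono-≤ (bool→ℕ-mono {X zero} {true} _) (count-≤ (X ∘ suc))

count-strict : ∀ {X Y : VSubset n} → X ⊆ Y → ∀ w → T (Y w) → ¬ T (X w) → count X < count Y
count-strict {X = X} {Y} X⊆Y w Yw ¬Xw = begin-strict
  count X                                          ≡⟨ count≡sum X ⟩
  sum (bool→ℕ ∘ X)                                 <⟨ m<m+n _ new ⟩
  sum (bool→ℕ ∘ X) + sum (bool→ℕ ∘ (Y ∖ X))        ≤⟨ sum-+-≤ split ⟩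
  sum (bool→ℕ ∘ Y)                                 ≡⟨ count≡sum Y ⟨
  count Y                                          ∎
  where
  open ≤-Reasoning
  new : 0 < sum (bool→ℕ ∘ (Y ∖ X))
  new = <-≤-trans (bool→ℕ-pos (∧-intro Yw (not-intro ¬Xw))) (≤-sum _ w)
  split : ∀ v → bool→ℕ (X v) + bool→ℕ ((Y ∖ X) v) ≤ bool→ℕ (Y v)
  split v = bool→ℕ-+-≤ (X⊆Y v) (proj₁ ∘ ∧-elim) λ Xv t → not-elim (proj₂ (∧-elim t)) Xv

EdgeSet : ℕ → Set
EdgeSet n = Fin n → Fin n → Bool

edges : EdgeSet n → ℕ
edges P = sumFin λ u → count (P u)

edges≡sum : (P : EdgeSet n) → edges P ≡ sum λ u → sum λ v → bool→ℕ (P u v)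
edges≡sum P = trans (sumFin≡sum λ u → count (P u)) (sum-cong-≗ λ u → count≡sum (P u))

edges-mono : {P Q : EdgeSet n} → (∀ u v → T (P u v) → T (Q u v)) → edges P ≤ edges Q
edges-mono {P = P} {Q} P⇒Q rewrite edges≡sum P | edges≡sum Q =
  sum-mono λ u → sum-mono λ v → bool→ℕ-mono (P⇒Q u v)

edges-+-≤ : {P Q R : EdgeSet n} →
            (∀ u v → T (P u v) → T (R u v)) → (∀ u v → T (Q u v) → T (R u v)) →
            (∀ u v → T (P u v) → T (Q u v) → ⊥) → edges P + edges Q ≤ edges R
edges-+-≤ {P = P} {Q} {R} P⇒R Q⇒R disj rewrite edges≡sum P | edges≡sum Q | edges≡sum R =
  sum-+-≤ λ u → sum-+-≤ λ v → bool→ℕ-+-≤ (P⇒R u v) (Q⇒R u v) (disj u v)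

edges-≤-+ : {P Q R : EdgeSet n} →
            (∀ u v → T (R u v) → T (P u v) ⊎ T (Q u v)) → edges R ≤ edges P + edges Q
edges-≤-+ {P = P} {Q} {R} cover rewrite edges≡sum P | edges≡sum Q | edges≡sum R =
  sum-≤-+ λ u → sum-≤-+ λ v → bool→ℕ-≤-+ (cover u v)

edges-transpose : {P Q : EdgeSet n} → (∀ u v → P u v ≡ Q v u) → edges P ≡ edges Q
edges-transpose {P = P} {Q} P≡Qᵀ = begin
  edges P                                ≡⟨ edges≡sum P ⟩
  (sum λ u → sum λ v → bool→ℕ (P u v))  ≡⟨ ∑-comm (λ u v → bool→ℕ (P u v)) ⟩
  (sum λ v → sum λ u → bool→ℕ (P u v))  ≡⟨ sum-cong-≗ (λ v → sum-cong-≗ (Pᵀ≗Q v)) ⟩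
  (sum λ v → sum λ u → bool→ℕ (Q v u))  ≡⟨ edges≡sum Q ⟨
  edges Q                                ∎
  where
  open ≡-Reasoning
  Pᵀ≗Q : ∀ v u → bool→ℕ (P u v) ≡ bool→ℕ (Q v u)
  Pᵀ≗Q v u = cong bool→ℕ (P≡Qᵀ u v)

edges-pos : {P : EdgeSet n} → ∀ u v → T (P u v) → 0 < edges P
edges-pos {P = P} u v Puv = subst (0 <_) (sym (edges≡sum P))
  (<-≤-trans (<-≤-trans (bool→ℕ-pos Puv) (≤-sum _ v)) (≤-sum _ u))

edges-witness : {P : EdgeSet n} → 0 < edges P → ∃₂ λ u v → T (P u v)
edges-witness {P = P} pos
  with u , pos′ ← sum-witness _ (subst (0 <_) (edges≡sum P) pos)
  with v , pos″ ← sum-witness _ pos′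
  = u , v , bool→ℕ-pos⁻¹ pos″

joins : Graph n → VSubset n → VSubset n → EdgeSet n
joins G X Y u v = adj G u v ∧ X u ∧ Y v

between : Graph n → VSubset n → VSubset n → ℕ
between G X Y = edges (joins G X Y)

module _ (G : Graph n) where

  joins-edge : ∀ X Y {a b} → T (joins G X Y a b) → T (adj G a b) × T (X a) × T (Y b)
  joins-edge X Y {a} {b} t with Gab , t′ ← ∧-elim {adj G a b} t = Gab , ∧-elim {X a} t′

  inCut-edge : ∀ X {a b} → T (inCut G X a b) → T (adj G a b) × T (X a) × ¬ T (X b)
  inCut-edge X t with Gab , Xa , ¬Xb ← joins-edge X (∁ X) t = Gab , Xa , not-elim ¬Xb

  cutSize-pos : ∀ X {a b} → T (adj G a b) → T (X a) → ¬ T (X b) → 0 < cutSize G X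
  cutSize-pos X {a} {b} e Xa ¬Xb =
    edges-pos {P = inCut G X} a b (∧-intro e (∧-intro Xa (not-intro ¬Xb)))

  between-sym : ∀ X Y → between G X Y ≡ between G Y X
  between-sym X Y = edges-transpose λ u v → cong₂ _∧_ (adj-sym G u v) (∧-comm (X u) (Y v))

  cutSize-∁ : ∀ S → cutSize G (∁ S) ≡ cutSize G S
  cutSize-∁ S = edges-transpose λ u v → cong₂ _∧_ (adj-sym G u v) (begin
    not (S u) ∧ not (not (S v))  ≡⟨ cong (not (S u) ∧_) (not-involutive (S v)) ⟩
    not (S u) ∧ S v              ≡⟨ ∧-comm (not (S u)) (S v) ⟩
    S v ∧ not (S u)              ∎)
    where open ≡-Reasoning

  between-cover : ∀ X {Y₁ Y₂ Z} → (∀ v → T (Z v) → T (Y₁ v) ⊎ T (Y₂ v)) →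
                  between G X Z ≤ between G X Y₁ + between G X Y₂
  between-cover X Z⊆Y₁∪Y₂ = edges-≤-+ λ u v → cover (adj G u v) (X u) (Z⊆Y₁∪Y₂ v)
    where
    cover : ∀ a x {z y₁ y₂} → (T z → T y₁ ⊎ T y₂) →
            T (a ∧ x ∧ z) → T (a ∧ x ∧ y₁) ⊎ T (a ∧ x ∧ y₂)
    cover true true h = h

  between-disjoint : ∀ {X₁ X₂ X} Y → X₁ ⊆ X → X₂ ⊆ X → (∀ u → T (X₁ u) → T (X₂ u) → ⊥) →
                     between G X₁ Y + between G X₂ Y ≤ between G X Y
  between-disjoint {X₁} {X₂} Y X₁⊆X X₂⊆X disj = edges-+-≤ (widen X₁⊆X) (widen X₂⊆X)
    λ u v t₁ t₂ → disj u (proj₁ (proj₂ (joins-edge X₁ Y t₁))) (proj₁ (proj₂ (joins-edge X₂ Y t₂)))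
    where
    widen : ∀ {X′ X} → X′ ⊆ X → ∀ u v → T (joins G X′ Y u v) → T (joins G X Y u v)
    widen {X′} X′⊆X u v t with e , X′u , Yv ← joins-edge X′ Y t =
      ∧-intro e (∧-intro (X′⊆X u X′u) Yv)

  cutSize-∩-∖ : ∀ p q → let e = between G (p ∩ q) (p ∖ q) in
                cutSize G (p ∩ q) + cutSize G (p ∖ q) ≤ (e + e) + cutSize G p
  cutSize-∩-∖ p q = begin
    cutSize G (p ∩ q) + cutSize G (p ∖ q)
      ≤⟨ +-mono-≤ (between-cover (p ∩ q) (λ v → leave-∩ (p v) (q v)))
                  (between-cover (p ∖ q) (λ v → leave-∖ (p v) (q v))) ⟩
    (e + x) + (between G (p ∖ q) (p ∩ q) + y)
      ≡⟨ cong (λ e′ → (e + x) + (e′ + y)) (between-sym (p ∖ q) (p ∩ q)) ⟩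
    (e + x) + (e + y)
      ≡⟨ interchange e x e y ⟩
    (e + e) + (x + y)
      ≤⟨ +-monoʳ-≤ (e + e)
           (between-disjoint (∁ p) (λ _ → proj₁ ∘ ∧-elim) (λ _ → proj₁ ∘ ∧-elim) ∩-∖-disjoint) ⟩
    (e + e) + cutSize G p
      ∎
    where
    open ≤-Reasoning
    e = between G (p ∩ q) (p ∖ q)
    x = between G (p ∩ q) (∁ p)
    y = between G (p ∖ q) (∁ p)
    leave-∩ : ∀ a b → T (not (a ∧ b)) → T (a ∧ not b) ⊎ T (not a)
    leave-∩ true  false _ = inj₁ _
    leave-∩ false _     _ = inj₂ _
    leave-∖ : ∀ a b → T (not (a ∧ not b)) → T (a ∧ b) ⊎ T (not a)
    leave-∖ true  true _ = inj₁ _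
    leave-∖ false _    _ = inj₂ _
    ∩-∖-disjoint : ∀ u → T ((p ∩ q) u) → T ((p ∖ q) u) → ⊥
    ∩-∖-disjoint u t₁ t₂ = not-elim (proj₂ (∧-elim {p u} t₂)) (proj₂ (∧-elim {p u} t₁))

  Connected-sym : ∀ {a b} → Connected G a b → Connected G b a
  Connected-sym = reverse λ {a} {b} e → subst T (adj-sym G a b) e

  path-leaves : ∀ X {a b} → Connected G a b → T (X a) → ¬ T (X b) → 0 < cutSize G X
  path-leaves X ε                    Xa ¬Xb = ⊥-elim (¬Xb Xa)
  path-leaves X (_◅_ {j = c} e path) Xa ¬Xb with T? (X c)
  ... | yes Xc = path-leaves X path Xc ¬Xb
  ... | no ¬Xc = cutSize-pos X e Xa ¬Xc

path-transfer : {A : Set} {R R′ : A → A → Set} (Q : A → Set) →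
                (∀ {x y} → Q x → R x y → R′ x y × Q y) →
                ∀ {x y} → Star R x y → Q x → Star R′ x y
path-transfer Q step ε        _  = ε
path-transfer Q step (r ◅ rs) Qx with r′ , Qy ← step Qx r = r′ ◅ path-transfer Q step rs Qy

module Saturation {n} (F : VSubset n → VSubset n)
  (F-inflationary : ∀ X → X ⊆ F X) (F-monotone : ∀ {X Y} → X ⊆ Y → F X ⊆ F Y) where

  stable-or-growing : ∀ Y → F Y ⊆ Y ⊎ ∃ λ w → T (F Y w) × ¬ T (Y w)
  stable-or-growing Y with any? (λ w → T? (F Y w) ×-dec ¬? (T? (Y w)))
  ... | yes new = inj₂ new
  ... | no ¬new = inj₁ λ w FYw → decidable-stable (T? (Y w)) λ ¬Yw → ¬new (w , FYw , ¬Yw)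

  fold-inflationary : ∀ X m → X ⊆ fold X F m
  fold-inflationary X zero    w Xw = Xw
  fold-inflationary X (suc m) w Xw = F-inflationary _ w (fold-inflationary X m w Xw)

  fold-stable-or-large : ∀ X m → F (fold X F m) ⊆ fold X F m ⊎ m ≤ count (fold X F m)
  fold-stable-or-large X zero = inj₂ z≤n
  fold-stable-or-large X (suc m) with stable-or-growing (fold X F m)
  ... | inj₁ stable = inj₁ (F-monotone stable)
  ... | inj₂ (w , new , old) with fold-stable-or-large X m
  ...   | inj₁ stable = ⊥-elim (old (stable w new))
  ...   | inj₂ large  = inj₂ (≤-<-trans large (count-strict (F-inflationary _) w new old))

  saturated : ∀ X → F (fold X F (suc n)) ⊆ fold X F (suc n)
  saturated X with fold-stable-or-large X (suc n)
  ... | inj₁ stable = stable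
  ... | inj₂ large  = ⊥-elim (1+n≰n (≤-trans large (count-≤ _)))

module Reachability {n} (E : EdgeSet n) where

  Path : Fin n → Fin n → Set
  Path = Star λ a b → T (E a b)

  step : VSubset n → VSubset n
  step X w = X w ∨ ⌊ any? (λ v → T? (X v ∧ E v w)) ⌋

  step-intro : ∀ {X v w} → T (X v) → T (E v w) → T (step X w)
  step-intro {X} {v} {w} Xv Evw =
    from T-∨ (inj₂ (fromWitness {a? = any? λ v → T? (X v ∧ E v w)} (v , ∧-intro Xv Evw)))

  step-elim : ∀ {X w} → T (step X w) → T (X w) ⊎ ∃ λ v → T (X v) × T (E v w)
  step-elim {X} t with to T-∨ t
  ... | inj₁ Xw = inj₁ Xw
  ... | inj₂ t′ with v , XvEvw ← toWitness t′ = inj₂ (v , ∧-elim {X v} XvEvw)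

  step-inflationary : ∀ X → X ⊆ step X
  step-inflationary X w Xw = from T-∨ (inj₁ Xw)

  step-monotone : ∀ {X Y} → X ⊆ Y → step X ⊆ step Y
  step-monotone X⊆Y w t with step-elim t
  ... | inj₁ Xw              = step-inflationary _ w (X⊆Y w Xw)
  ... | inj₂ (v , Xv , Evw) = step-intro (X⊆Y v Xv) Evw

  open Saturation step step-inflationary step-monotone

  reachable : Fin n → VSubset n
  reachable u = fold (λ w → ⌊ u ≟ w ⌋) step (suc n)

  reachable-refl : ∀ u → T (reachable u u)
  reachable-refl u = fold-inflationary _ (suc n) u (fromWitness refl)

  reachable-closed : ∀ {u a b} → T (reachable u a) → T (E a b) → T (reachable u b)
  reachable-closed {b = b} ua Eab = saturated _ b (step-intro ua Eab)

  reachable-sound : ∀ {u w} → T (reachable u w) → Path u w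
  reachable-sound {u} = fold-sound (suc n) _
    where
    fold-sound : ∀ m w → T (fold (λ w → ⌊ u ≟ w ⌋) step m w) → Path u w
    fold-sound zero    w t with refl ← toWitness t = ε
    fold-sound (suc m) w t with step-elim t
    ... | inj₁ uw              = fold-sound m w uw
    ... | inj₂ (v , uv , Evw) = fold-sound m v uv ◅◅ (Evw ◅ ε)

open Reachability using (reachable; reachable-refl; reachable-closed; reachable-sound)

module _ (G : Graph n) (S : VSubset n) where

  deleteCut-edge : ∀ {a b} → T (adj (deleteCut G S) a b) → T (adj G a b) × S a ≡ S b
  deleteCut-edge {a} {b} e with Gab , ¬crosses ← ∧-elim {adj G a b} e = Gab , same-side ¬crosses
    where
    same-side : T (not (crosses S a b)) → S a ≡ S b
    same-side with S a | S b
    ... | true  | true  = λ _ → refl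
    ... | false | false = λ _ → refl
    ... | true  | false = λ ()
    ... | false | true  = λ ()

  deleteCut-keeps : ∀ {a b} → T (adj G a b) → S a ≡ S b → T (adj (deleteCut G S) a b)
  deleteCut-keeps {a} {b} e = ∧-intro e ∘ not-crossing
    where
    not-crossing : S a ≡ S b → T (not (crosses S a b))
    not-crossing with S a | S b
    ... | true  | true  = λ _ → _
    ... | false | false = λ _ → _
    ... | true  | false = λ ()
    ... | false | true  = λ ()

two-near-minimum-cuts : ∀ ℓ e w → ℓ + ℓ ≤ (e + e) + w → 100 * w ≤ 101 * ℓ → ℓ ≤ 5 * e
two-near-minimum-cuts ℓ e w ℓ+ℓ≤ w-near = *-cancelˡ-≤ 99 (begin
  99 * ℓ        ≤⟨ +-cancelʳ-≤ (101 * ℓ) (99 * ℓ) (200 * e) scaled ⟩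
  200 * e       ≤⟨ *-monoˡ-≤ e (m≤m+n 200 295) ⟩
  495 * e       ≡⟨ solve (e ∷ []) ⟩
  99 * (5 * e)  ∎)
  where
  open ≤-Reasoning
  scaled : 99 * ℓ + 101 * ℓ ≤ 200 * e + 101 * ℓ
  scaled = begin
    99 * ℓ + 101 * ℓ     ≡⟨ solve (ℓ ∷ []) ⟩
    100 * (ℓ + ℓ)        ≤⟨ *-monoʳ-≤ 100 ℓ+ℓ≤ ⟩
    100 * ((e + e) + w)  ≡⟨ solve (e ∷ w ∷ []) ⟩
    200 * e + 100 * w    ≤⟨ +-monoʳ-≤ (200 * e) w-near ⟩
    200 * e + 101 * ℓ    ∎

min-cut-pos : (G : Graph n) {ℓ : ℕ} → IsMinNonEmptyCut G ℓ → 0 < ℓ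
min-cut-pos G ((_ , pos , refl) , _) = pos

ClosedWithin : Graph n → VSubset n → VSubset n → Set
ClosedWithin G p R = ∀ {a b} → T (adj G a b) → T (p a) → T (p b) → T (R a) → T (R b)

KeepsEdgesWithin : Graph n → VSubset n → Graph n → Set
KeepsEdgesWithin G p H = ∀ {a b} → T (adj G a b) → T (p a) → T (p b) → T (adj H a b)

module NearMinimumCut {n} (G : Graph n) {ℓ} (ℓ-min : IsMinNonEmptyCut G ℓ)
                      (p : VSubset n) (p-near : 100 * cutSize G p ≤ 101 * ℓ) where

  split-bound : ∀ q → 0 < cutSize G (p ∩ q) → 0 < cutSize G (p ∖ q) →
                ℓ ≤ 5 * between G (p ∩ q) (p ∖ q)
  split-bound q pos₁ pos₂ =
    two-near-minimum-cuts ℓ (between G (p ∩ q) (p ∖ q)) (cutSize G p)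
      (≤-trans (+-mono-≤ (proj₂ ℓ-min (p ∩ q) pos₁) (proj₂ ℓ-min (p ∖ q) pos₂)) (cutSize-∩-∖ G p q))
      p-near

  closed-split-impossible : ∀ R → ClosedWithin G p R →
                            0 < cutSize G (p ∩ R) → 0 < cutSize G (p ∖ R) → ⊥
  closed-split-impossible R closed pos₁ pos₂ =
    <⇒≱ (min-cut-pos G ℓ-min) (≤-trans (split-bound R pos₁ pos₂) (*-monoʳ-≤ 5 no-edge))
    where
    no-edge : between G (p ∩ R) (p ∖ R) ≤ 0
    no-edge = ≮⇒≥ λ pos →
      let _ , _ , t     = edges-witness {P = joins G (p ∩ R) (p ∖ R)} pos
          e , pR , p¬R = joins-edge G (p ∩ R) (p ∖ R) t
          pa , Ra       = ∧-elim {p _} pR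
          pb , ¬Rb      = ∧-elim {p _} p¬R
      in not-elim ¬Rb (closed e pa pb Ra)

  connected-within : ∀ H → KeepsEdgesWithin G p H →
                     ∀ {u v} → T (p u) → T (p v) → Connected G u v → Connected H u v
  connected-within H keeps {u} {v} pu pv path with T? (reachable (adj H) u v)
  ... | yes u→v = reachable-sound (adj H) u→v
  ... | no ¬u→v = ⊥-elim (closed-split-impossible R
      (λ e pa pb Ra → reachable-closed (adj H) Ra (keeps e pa pb))
      (path-leaves G (p ∩ R) path (∧-intro pu u→u) (¬u→v ∘ proj₂ ∘ ∧-elim {p v}))
      (path-leaves G (p ∖ R) (Connected-sym G path) (∧-intro pv (not-intro ¬u→v))
        λ t → not-elim (proj₂ (∧-elim {p u} t)) u→u))
    where
    R = reachable (adj H) u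
    u→u = reachable-refl (adj H) u

  cut-edges-connected : ∀ {u₀ v₀ x y} → T (inCut G p u₀ v₀) → T (inCut G p x y) → Connected G u₀ x
  cut-edges-connected {u₀} {x = x} t₀ t
    with e₀ , pu₀ , ¬pv₀ ← inCut-edge G p t₀
    with e  , px  , ¬py  ← inCut-edge G p t
    with T? (reachable (adj G) u₀ x)
  ... | yes u₀→x = reachable-sound (adj G) u₀→x
  ... | no ¬u₀→x = ⊥-elim (closed-split-impossible R
      (λ e _ _ Ra → reachable-closed (adj G) Ra e)
      (cutSize-pos G (p ∩ R) e₀ (∧-intro pu₀ (reachable-refl (adj G) u₀)) (¬pv₀ ∘ proj₁ ∘ ∧-elim))
      (cutSize-pos G (p ∖ R) e  (∧-intro px (not-intro ¬u₀→x))           (¬py ∘ proj₁ ∘ ∧-elim)))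
    where R = reachable (adj G) u₀

  inner-edge-bound : ∀ H → KeepsEdgesWithin G p H →
                     ∀ S′ {u v} → T (adj G u v) → T (p u) → T (p v) → T (S′ u) → ¬ T (S′ v) →
                     ℓ ≤ 5 * cutSize H S′
  inner-edge-bound H keeps S′ {u} {v} e pu pv S′u ¬S′v =
    ≤-trans (split-bound S′ leaves-p∩S′ leaves-p∖S′) (*-monoʳ-≤ 5 (edges-mono kept))
    where
    leaves-p∩S′ : 0 < cutSize G (p ∩ S′)
    leaves-p∩S′ = cutSize-pos G (p ∩ S′) e (∧-intro pu S′u) (¬S′v ∘ proj₂ ∘ ∧-elim {p v})
    leaves-p∖S′ : 0 < cutSize G (p ∖ S′)
    leaves-p∖S′ = cutSize-pos G (p ∖ S′) (subst T (adj-sym G u v) e) (∧-intro pv (not-intro ¬S′v))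
      λ t → not-elim (proj₂ (∧-elim {p u} t)) S′u
    kept : ∀ a b → T (joins G (p ∩ S′) (p ∖ S′) a b) → T (inCut H S′ a b)
    kept a b t
      with e , pS′ , p¬S′ ← joins-edge G (p ∩ S′) (p ∖ S′) t
      with pa , S′a ← ∧-elim {p a} pS′
      with pb , ¬S′b ← ∧-elim {p b} p¬S′
      = ∧-intro (keeps e pa pb) (∧-intro S′a ¬S′b)

module SplitComponent {n k} (H : Graph n) (f : Fin n → Fin k) (i₀ : Fin k) (p : VSubset n) where

  relabel : Fin k → Bool → Fin (suc k)
  relabel j true  = suc j
  relabel j false with j ≟ i₀
  ... | yes _ = zero
  ... | no  _ = suc j

  relabel-view : ∀ j b → (j ≡ i₀ × b ≡ false × relabel j b ≡ zero)
                       ⊎ ((j ≡ i₀ → b ≡ true) × relabel j b ≡ suc j)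
  relabel-view j true = inj₂ ((λ _ → refl) , refl)
  relabel-view j false with j ≟ i₀
  ... | yes j≡i₀ = inj₁ (j≡i₀ , refl , refl)
  ... | no  j≢i₀ = inj₂ ((λ j≡i₀ → ⊥-elim (j≢i₀ j≡i₀)) , refl)

  relabel-i₀-false : relabel i₀ false ≡ zero
  relabel-i₀-false with relabel-view i₀ false
  ... | inj₁ (_ , _ , r)   = r
  ... | inj₂ (i₀⇒true , _) with () ← i₀⇒true refl

  relabel-off : ∀ {j} b → j ≢ i₀ → relabel j b ≡ suc j
  relabel-off {j} b j≢i₀ with relabel-view j b
  ... | inj₁ (j≡i₀ , _) = ⊥-elim (j≢i₀ j≡i₀)
  ... | inj₂ (_ , r)    = r

  relabel-injective : ∀ {j j′ b b′} → relabel j b ≡ relabel j′ b′ → j ≡ j′ × (j ≡ i₀ → b ≡ b′)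
  relabel-injective {j} {j′} {b} {b′} eq with relabel-view j b | relabel-view j′ b′
  ... | inj₁ (j≡i₀ , b≡f , _) | inj₁ (j′≡i₀ , b′≡f , _) =
    trans j≡i₀ (sym j′≡i₀) , λ _ → trans b≡f (sym b′≡f)
  ... | inj₁ (_ , _ , r)      | inj₂ (_ , r′)           =
    ⊥-elim (0≢1+n (trans (sym r) (trans eq r′)))
  ... | inj₂ (_ , r)          | inj₁ (_ , _ , r′)       =
    ⊥-elim (0≢1+n (trans (sym r′) (trans (sym eq) r)))
  ... | inj₂ (j≡i₀⇒t , r)     | inj₂ (j′≡i₀⇒t , r′)     =
    j≡j′ , λ j≡i₀ → trans (j≡i₀⇒t j≡i₀) (sym (j′≡i₀⇒t (trans (sym j≡j′) j≡i₀)))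
    where j≡j′ = suc-injective (trans (sym r) (trans eq r′))

  split-component : (∀ i → ∃ λ u → f u ≡ i) →
                    (∀ {a b} → T (adj H a b) → f a ≡ f b × p a ≡ p b) →
                    (∀ {u v} → f u ≡ f v → (f u ≡ i₀ → p u ≡ p v) → Connected H u v) →
                    (∃ λ u → f u ≡ i₀ × p u ≡ true) → (∃ λ v → f v ≡ i₀ × p v ≡ false) →
                    HasComponents H (suc k)
  split-component f-surj edge-preserves connects (u₀ , fu₀ , pu₀) (v₀ , fv₀ , pv₀) =
    g , g-surj , (λ _ _ → uncurry connects ∘ relabel-injective) ,
    (λ _ _ → Star.gfold g _≡_ (trans ∘ g-edge) refl)
    where
    g : Fin n → Fin (suc k)
    g u = relabel (f u) (p u)
    g-edge : ∀ {a b} → T (adj H a b) → g a ≡ g b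
    g-edge = uncurry (cong₂ relabel) ∘ edge-preserves
    g-surj : ∀ i → ∃ λ u → g u ≡ i
    g-surj zero    = v₀ , trans (cong₂ relabel fv₀ pv₀) relabel-i₀-false
    g-surj (suc j) with j ≟ i₀
    ... | yes refl = u₀ , cong₂ relabel fu₀ pu₀
    ... | no  j≢i₀ with w , refl ← f-surj j = w , relabel-off (p w) j≢i₀

module AfterDeletion {n} (G : Graph n) {ℓ} (ℓ-min : IsMinNonEmptyCut G ℓ) (S : VSubset n)
                     (S-large : ℓ ≤ cutSize G S) (S-near : 100 * cutSize G S ≤ 101 * ℓ) where

  private
    H = deleteCut G S

  side : Bool → VSubset n
  side true  = S
  side false = ∁ S

  side-⇔ : ∀ b {u} → T (side b u) ⇔ (S u ≡ b)
  side-⇔ true  = T-≡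
  side-⇔ false = T-not-≡

  side-near : ∀ b → 100 * cutSize G (side b) ≤ 101 * ℓ
  side-near true  = S-near
  side-near false = subst (λ c → 100 * c ≤ 101 * ℓ) (sym (cutSize-∁ G S)) S-near

  keeps-side : ∀ b → KeepsEdgesWithin G (side b) H
  keeps-side b e pa pb = deleteCut-keeps G S e (trans (to (side-⇔ b) pa) (sym (to (side-⇔ b) pb)))

  module Side (b : Bool) = NearMinimumCut G ℓ-min (side b) (side-near b)

  same-side-connected : ∀ {u v} → S u ≡ S v → Connected G u v → Connected H u v
  same-side-connected {u} Su≡Sv = Side.connected-within (S u) H (keeps-side (S u))
    (from (side-⇔ (S u)) refl) (from (side-⇔ (S u)) (sym Su≡Sv))

  cut-bound : ∀ S′ → 0 < cutSize H S′ → ℓ ≤ 5 * cutSize H S′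
  cut-bound S′ pos
    with u , _ , t      ← edges-witness {P = inCut H S′} pos
    with e , S′u , ¬S′v ← inCut-edge H S′ t
    with Ge , Su≡Sv     ← deleteCut-edge G S e
    = Side.inner-edge-bound (S u) H (keeps-side (S u)) S′ Ge
        (from (side-⇔ (S u)) refl) (from (side-⇔ (S u)) (sym Su≡Sv)) S′u ¬S′v

  private
    cut-edge : ∃₂ λ u₀ v₀ → T (inCut G S u₀ v₀)
    cut-edge = edges-witness {P = inCut G S} (<-≤-trans (min-cut-pos G ℓ-min) S-large)

    u₀ v₀ : Fin n
    u₀ = proj₁ cut-edge
    v₀ = proj₁ (proj₂ cut-edge)

    u₀v₀-in-cut : T (inCut G S u₀ v₀)
    u₀v₀-in-cut = proj₂ (proj₂ cut-edge)

  crossing-edge-connected : ∀ {a b} → T (adj G a b) → S a ≢ S b → Connected G u₀ a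
  crossing-edge-connected {a} {b} e Sa≢Sb with S a in Sa | S b in Sb
  ... | true  | true  = ⊥-elim (Sa≢Sb refl)
  ... | false | false = ⊥-elim (Sa≢Sb refl)
  ... | true  | false = Side.cut-edges-connected true u₀v₀-in-cut
        (∧-intro e (∧-intro (from T-≡ Sa) (from T-not-≡ Sb)))
  ... | false | true  = Side.cut-edges-connected true u₀v₀-in-cut
        (∧-intro e′ (∧-intro (from T-≡ Sb) (from T-not-≡ Sa))) ◅◅ (e′ ◅ ε)
    where e′ = subst T (adj-sym G a b) e

  components : ∀ k → HasComponents G k → HasComponents H (suc k)
  components _ (f , f-surj , f-connected , f-respects)
    with e₀ , Su₀ , ¬Sv₀ ← inCut-edge G S u₀v₀-in-cut
    = split-component f-surj edge-preserves connects
        (u₀ , refl , to T-≡ Su₀) (v₀ , sym (f-edge e₀) , to T-not-≡ (not-intro ¬Sv₀))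
    where
    open SplitComponent H f (f u₀) S
    f-edge : ∀ {a b} → T (adj G a b) → f a ≡ f b
    f-edge {a} {b} e = f-respects a b (e ◅ ε)
    edge-preserves : ∀ {a b} → T (adj H a b) → f a ≡ f b × S a ≡ S b
    edge-preserves e with Ge , Sa≡Sb ← deleteCut-edge G S e = f-edge Ge , Sa≡Sb
    outside-kept : ∀ {a b} → f a ≢ f u₀ → T (adj G a b) → T (adj H a b) × f b ≢ f u₀
    outside-kept {a} {b} fa≢ e with S a Bool.≟ S b
    ... | yes Sa≡Sb = deleteCut-keeps G S e Sa≡Sb , fa≢ ∘ trans (f-edge e)
    ... | no  Sa≢Sb = ⊥-elim (fa≢ (sym (f-respects u₀ a (crossing-edge-connected e Sa≢Sb))))
    connects : ∀ {u v} → f u ≡ f v → (f u ≡ f u₀ → S u ≡ S v) → Connected H u v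
    connects {u} fu≡fv same with f u ≟ f u₀
    ... | yes fu≡ = same-side-connected (same fu≡) (f-connected _ _ fu≡fv)
    ... | no  fu≢ = path-transfer (λ a → f a ≢ f u₀) outside-kept (f-connected _ _ fu≡fv) fu≢

claim3p8 : ∀ {n} (G : Graph n) (ℓ : ℕ) → IsMinNonEmptyCut G ℓ →
    ∀ (S : VSubset n) → ℓ ≤ cutSize G S → 100 * cutSize G S ≤ 101 * ℓ →
    (∀ k → HasComponents G k → HasComponents (deleteCut G S) (suc k))
    × (∀ S′ → 0 < cutSize (deleteCut G S) S′ →
         ℓ ≤ 5 * cutSize (deleteCut G S) S′)
claim3p8 G ℓ ℓ-min S S-large S-near = components , cut-bound
  where open AfterDeletion G ℓ-min S S-large S-near
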